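{- There exists an infinite family of bipartite permutation graphs whose rank-width is $\Omega(\sqrt{n})$, where $n$ denotes the number of vertices.
   Context: A permutation graph is a graph having an intersection model consisting of straight line segments (one per vertex) between two parallel lines; a bipartite permutation graph is a permutation graph that is bipartite. For $A\subseteq V(G)$ write $\overline{A}=V(G)\setminus A$ and let $\mathrm{cut\text{ - }rank}(A)$ be the rank over $\mathrm{GF}(2)$ of the $A\times\overline{A}$ biadjacency matrix. A decomposition tree of $G$ is a pair $(T,\delta)$ where $T$ is a tree whose internal nodes have degree three and which has $|V(G)|$ leaves, and $\delta$ is a bijection between $V(G)$ and the leaves of $T$; each edge of $T$ defines a cut $\{A,\overline{A}\}$. The rank-width of $(T,\delta)$ is the maximum of $\mathrm{cut\text{ - }rank}(A)$ over cuts given by edges of $T$, and the rank-width of $G$ is the minimum over all decomposition trees of $G$. -}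

module Defs where

open import Data.Nat using (ℕ; zero; suc; _+_; _*_; _≤_; _<_)
open import Data.Fin using (Fin; zero; suc)
open import Data.Bool using (Bool; true; false; _∧_; _xor_)
open import Data.List using (List; []; _∷_; _++_; allFin)
open import Data.List.Membership.Propositional using (_∈_)
open import Data.List.Relation.Binary.Permutation.Propositional using (_↭_)
open import Data.Product using (Σ; ∃; ∃-syntax; _×_; _,_)
open import Data.Sum using (_⊎_)
open import Function.Bundles using (_⇔_)
open import Relation.Nullary using (¬_)
open import Relation.Binary.PropositionalEquality using (_≡_; _≢_)
open import Function.Definitions using (Injective)

record Graph (n : ℕ) : Set where
  field
    adj     : Fin n → Fin n → Bool
    adj-sym : ∀ u v → adj u v ≡ adj v u
    adj-irr : ∀ u → adj u u ≡ false

open Graph public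

-- Permutation graphs: intersection model by straight line segments
-- between two parallel lines.  Segment of vertex v joins position
-- top v on the upper line to position bot v on the lower line.
-- Positions are natural numbers (any finite real configuration is
-- order-isomorphic, ties included, to one in ℕ).  Two such segments
-- meet iff (top u - top v)(bot u - bot v) ≤ 0.

SegmentsIntersect : ℕ → ℕ → ℕ → ℕ → Set
SegmentsIntersect tu bu tv bv = (tu ≤ tv × bv ≤ bu) ⊎ (tv ≤ tu × bu ≤ bv)

IsPermutationGraph : ∀ {n} → Graph n → Set
IsPermutationGraph {n} G =
  Σ (Fin n → ℕ) λ top → Σ (Fin n → ℕ) λ bot →
    ∀ u v → (adj G u v ≡ true) ⇔ (u ≢ v × SegmentsIntersect (top u) (bot u) (top v) (bot v))

IsBipartite : ∀ {n} → Graph n → Set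
IsBipartite {n} G = Σ (Fin n → Bool) λ col → ∀ u v → adj G u v ≡ true → col u ≢ col v

IsBipartitePermutationGraph : ∀ {n} → Graph n → Set
IsBipartitePermutationGraph G = IsPermutationGraph G × IsBipartite G

-- Cut-rank over GF(2) (GF(2) = Bool with xor as + and ∧ as ·).

xorSum : (k : ℕ) → (Fin k → Bool) → Bool
xorSum zero    f = false
xorSum (suc k) f = f zero xor xorSum k (λ i → f (suc i))

-- The rows of the A × Ā biadjacency matrix indexed by S are linearly
-- independent over GF(2): any GF(2)-combination summing to the zero
-- vector (on all columns w ∈ Ā) has all coefficients zero.
RowsIndependent : ∀ {n} → Graph n → (Fin n → Set) → (k : ℕ) → (Fin k → Fin n) → Set
RowsIndependent {n} G A k S =
  (c : Fin k → Bool) →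
  (∀ (w : Fin n) → ¬ A w → xorSum k (λ i → c i ∧ adj G (S i) w) ≡ false) →
  ∀ i → c i ≡ false

-- cut-rank(A) ≥ k : the A × Ā biadjacency matrix has k linearly
-- independent rows (rank = maximal number of independent rows).
CutRankAtLeast : ∀ {n} → Graph n → (Fin n → Set) → ℕ → Set
CutRankAtLeast {n} G A k =
  Σ (Fin k → Fin n) λ S → (∀ i → A (S i)) × RowsIndependent G A k S

-- A tree with internal nodes of degree three and
-- leaves labelled bijectively by V(G) is represented by rooting it at a
-- subdivided edge: a full binary tree whose leaf list is a permutation
-- of V(G).  The cuts given by edges of the unrooted tree are exactly the
-- leaf sets of subtrees at non-root nodes (the two children of the root
-- give the same cut, coming from the subdivided edge).

data BTree (n : ℕ) : Set where
  leaf : Fin n → BTree n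
  node : BTree n → BTree n → BTree n

leaves : ∀ {n} → BTree n → List (Fin n)
leaves (leaf v)   = v ∷ []
leaves (node l r) = leaves l ++ leaves r

properSubtrees : ∀ {n} → BTree n → List (BTree n)
properSubtrees (leaf v)   = []
properSubtrees (node l r) = (l ∷ properSubtrees l) ++ (r ∷ properSubtrees r)

IsDecompositionTree : ∀ {n} → BTree n → Set
IsDecompositionTree {n} t = leaves t ↭ allFin n

-- the side A of the cut given by the edge above subtree s
cutOf : ∀ {n} → BTree n → Fin n → Set
cutOf s v = v ∈ leaves s

WidthAtLeast : ∀ {n} → Graph n → BTree n → ℕ → Set
WidthAtLeast G t k = ∃[ s ] (s ∈ properSubtrees t × CutRankAtLeast G (cutOf s) k)

-- rank-width of G is ≥ k : every decomposition tree has width ≥ k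
-- (rank-width is the minimum width over all decomposition trees).
RankWidthAtLeast : ∀ {n} → Graph n → ℕ → Set
RankWidthAtLeast {n} G k = (t : BTree n) → IsDecompositionTree t → WidthAtLeast G t k

module Submission where

-- For k ≥ 1 let D = 12k and M = kD, and let H be the band graph with vertices X_a, Y_b
-- (a, b < M), where X_a is the segment from a on the upper line to a + D on the lower
-- line and Y_b the vertical segment at b.  H is a bipartite permutation graph with
-- X_a ~ Y_b iff a ≤ b ≤ a + D, on n = 24k² ≤ (5k)² vertices; we show rank-width H ≥ k.
--
-- Mark the D = 3L vertices X_c (c < D),
-- where L = 4k; some cut then has at least L marked vertices on each side.  Each c < D
-- spans a column path X_c, Y_{D+c}, X_{D+c}, Y_{2D+c}, … through k rows.  If each side
-- has a column not crossed by the cut, two such columns give a triangular k × k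
-- submatrix; otherwise L crossed columns give L distinct crossing edges, k of which
-- cross in the same one of four ways and again form a triangular system.

open import Defs
open import Data.Nat using (ℕ; _*_; _≤_; _^_)
open import Data.Product using (Σ; _×_)

open import Data.Nat
open import Data.Nat.Properties
open import Data.Nat.DivMod using (_mod_; m<n⇒m%n≡m; [m+kn]%n≡m%n)
open import Data.Nat.Tactic.RingSolver using (solve-∀)
open import Data.Bool using (Bool; true; false; _∧_) renaming (_≟_ to _≟ᵇ_)
open import Data.Bool.Properties using (∧-zeroʳ; ∧-identityʳ; xor-identityʳ)
open import Data.Fin using (Fin; zero; suc; toℕ; inject≤; splitAt; _↑ˡ_; _↑ʳ_)
import Data.Fin.Properties as FinP
open FinP using (inject≤-injective; splitAt-↑ˡ; splitAt-↑ʳ; splitAt⁻¹-↑ˡ; splitAt⁻¹-↑ʳ)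
open import Data.List using (List; []; _∷_; _++_; length; lookup; filter; allFin; tabulate; map; upTo)
open import Data.List.Properties
  using (length-upTo; length-map; length-++; length-filter; filter-all; filter-++; filter-none; ++-assoc; map-tabulate)
open import Data.List.Membership.Propositional using (_∈_; _∉_; find)
open import Data.List.Membership.Propositional.Properties
  using (∈-upTo⁻; ∈-map⁻; ∈-filter⁻; ∈-lookup; ∈-++⁻; ∈-++⁺ˡ; ∈-++⁺ʳ)
open import Data.List.Relation.Unary.Any using (here; there)
open import Data.List.Relation.Unary.All as All using (All; []; _∷_)
import Data.List.Relation.Unary.All.Properties as All
open import Data.List.Relation.Unary.AllPairs using ([]; _∷_)
open import Data.List.Relation.Unary.Unique.Propositional using (Unique)
open import Data.List.Relation.Unary.Unique.Propositional.Properties using (upTo⁺; allFin⁺; filter⁺; map⁺)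
open import Data.List.Relation.Binary.Permutation.Propositional
  using (_↭_; ↭-refl; ↭-sym; ↭-trans; ↭-reflexive; ↭⇒↭ₛ)
open import Data.List.Relation.Binary.Permutation.Propositional.Properties
  using (++⁺ˡ; ++⁺ʳ; ++-comm; shifts; ↭-length; filter-↭)
import Data.List.Relation.Binary.Permutation.Setoid.Properties as PermutationSetoid
open import Data.Product using (∃; _,_; proj₁; proj₂)
open import Data.Sum using (_⊎_; inj₁; inj₂; [_,_]′)
open import Data.Empty using (⊥-elim)
open import Relation.Nullary using (¬_; ¬?; Dec; yes; no; does; _⊎-dec_; _×-dec_)
open import Relation.Nullary.Decidable using (dec-true; dec-false; does-⇔)
open import Relation.Unary using (Decidable)
open import Relation.Binary.Definitions using (tri<; tri≈; tri>)
open import Relation.Binary.PropositionalEquality hiding ([_])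
open import Function using (_∘_; id; mk⇔)

xorSum-zeros : ∀ k (f : Fin k → Bool) → (∀ j → f j ≡ false) → xorSum k f ≡ false
xorSum-zeros zero    f zeros = refl
xorSum-zeros (suc k) f zeros rewrite zeros zero =
  xorSum-zeros k (λ j → f (suc j)) (λ j → zeros (suc j))

xorSum-single : ∀ k (f : Fin k → Bool) i → (∀ j → j ≢ i → f j ≡ false) → xorSum k f ≡ f i
xorSum-single (suc k) f zero others
  rewrite xorSum-zeros k (λ j → f (suc j)) (λ j → others (suc j) (λ ())) = xor-identityʳ (f zero)
xorSum-single (suc k) f (suc i) others rewrite others zero (λ ()) =
  xorSum-single k (λ j → f (suc j)) i (λ j j≢i → others (suc j) (j≢i ∘ FinP.suc-injective))

module _ {n} (G : Graph n) (A : Fin n → Set) where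

  -- Rows S i ∈ A with pivot columns P i ∉ A, S i ~ P i, such that, for an injective
  -- ranking of the rows, no row meets the pivot of a row of smaller rank, are
  -- independent: evaluating a vanishing combination at the pivot of row i kills every
  -- other row, provided the rows of smaller rank already have coefficient zero.
  triangular⇒independent : ∀ k (S P : Fin k → Fin n) (rank : Fin k → ℕ) →
    (∀ i j → rank i ≡ rank j → i ≡ j) →
    (∀ i → adj G (S i) (P i) ≡ true) →
    (∀ i → ¬ A (P i)) →
    (∀ i j → rank i < rank j → adj G (S j) (P i) ≡ false) →
    RowsIndependent G A k S
  triangular⇒independent k S P rank rank-inj pivot pivot∉A upper c vanishes i =
    belowRank (suc (rank i)) i ≤-refl
    where
    atPivot : ∀ i → (∀ j → rank j < rank i → c j ≡ false) → c i ≡ false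
    atPivot i lower = begin
      c i                                       ≡⟨ ∧-identityʳ (c i) ⟨
      c i ∧ true                                ≡⟨ cong (c i ∧_) (pivot i) ⟨
      c i ∧ adj G (S i) (P i)                   ≡⟨ xorSum-single k _ i others ⟨
      xorSum k (λ j → c j ∧ adj G (S j) (P i))  ≡⟨ vanishes (P i) (pivot∉A i) ⟩
      false                                     ∎
      where
      open ≡-Reasoning
      others : ∀ j → j ≢ i → c j ∧ adj G (S j) (P i) ≡ false
      others j j≢i with <-cmp (rank j) (rank i)
      ... | tri< lt _ _ rewrite lower j lt = refl
      ... | tri≈ _ eq _ = ⊥-elim (j≢i (rank-inj j i eq))
      ... | tri> _ _ gt rewrite upper i j gt = ∧-zeroʳ (c j)

    belowRank : ∀ m i → rank i < m → c i ≡ false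
    belowRank zero    i ()
    belowRank (suc m) i i<1+m = atPivot i (λ j j<i → belowRank m j (<-≤-trans j<i (s≤s⁻¹ i<1+m)))

  record TriangularSystem {I : Set} (xs : List I) : Set where
    field
      row col        : I → Fin n
      rank           : I → ℕ
      row∈A          : ∀ {x} → x ∈ xs → A (row x)
      col∉A          : ∀ {x} → x ∈ xs → ¬ A (col x)
      pivot          : ∀ {x} → x ∈ xs → adj G (row x) (col x) ≡ true
      rank-injective : ∀ {x y} → x ∈ xs → y ∈ xs → rank x ≡ rank y → x ≡ y
      upper          : ∀ {x y} → x ∈ xs → y ∈ xs → rank x < rank y → adj G (row y) (col x) ≡ false

  lookup-injective : ∀ {I : Set} {xs : List I} → Unique xs → ∀ i j → lookup xs i ≡ lookup xs j → i ≡ j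
  lookup-injective (_ ∷ _)      zero    zero    _  = refl
  lookup-injective (x∉ ∷ _)     zero    (suc j) eq = ⊥-elim (All.lookup x∉ (∈-lookup j) eq)
  lookup-injective (x∉ ∷ _)     (suc i) zero    eq = ⊥-elim (All.lookup x∉ (∈-lookup i) (sym eq))
  lookup-injective (_ ∷ unique) (suc i) (suc j) eq = cong suc (lookup-injective unique i j eq)

  triangular⇒cutRank : ∀ {I : Set} k {xs : List I} → Unique xs → k ≤ length xs →
    TriangularSystem xs → CutRankAtLeast G A k
  triangular⇒cutRank {I} k {xs} unique k≤len T =
    row ∘ el , row∈A ∘ mem ,
    triangular⇒independent k (row ∘ el) (col ∘ el) (rank ∘ el)
      (λ i j eq → inject≤-injective k≤len k≤len i j
                    (lookup-injective unique _ _ (rank-injective (mem i) (mem j) eq)))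
      (pivot ∘ mem) (col∉A ∘ mem) (λ i j lt → upper (mem i) (mem j) lt)
    where
    open TriangularSystem T
    el : Fin k → I
    el i = lookup xs (inject≤ i k≤len)
    mem : ∀ i → el i ∈ xs
    mem i = ∈-lookup (inject≤ i k≤len)

unique-++⁻ : ∀ {I : Set} (xs : List I) {ys} → Unique (xs ++ ys) →
  Unique xs × Unique ys × (∀ {y} → y ∈ ys → y ∉ xs)
unique-++⁻ []       unique     = [] , unique , λ _ ()
unique-++⁻ (x ∷ xs) (x∉ ∷ unique) with unique-++⁻ xs unique
... | uxs , uys , disjoint =
  All.++⁻ˡ xs x∉ ∷ uxs , uys ,
  λ { y∈ys (here refl) → All.lookup (All.++⁻ʳ xs x∉) y∈ys refl ; y∈ys (there y∈xs) → disjoint y∈ys y∈xs }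

unique-↭ : ∀ {I : Set} {xs ys : List I} → xs ↭ ys → Unique xs → Unique ys
unique-↭ {I} xs↭ys = PermutationSetoid.Unique-resp-↭ (setoid I) (↭⇒↭ₛ xs↭ys)

unique-map⁺ : ∀ {I J : Set} {Q : I → Set} (f : I → J) → (∀ {x y} → Q x → Q y → f x ≡ f y → x ≡ y) →
  ∀ {xs} → Unique xs → All Q xs → Unique (map f xs)
unique-map⁺ f inj {[]}     []          []         = []
unique-map⁺ {Q = Q} f inj {x ∷ xs} (x∉ ∷ uxs) (qx ∷ qxs) = images x∉ qxs ∷ unique-map⁺ f inj uxs qxs
  where
  images : ∀ {ys} → All (x ≢_) ys → All Q ys → All (f x ≢_) (map f ys)
  images []         []         = []
  images (x≢y ∷ ne) (qy ∷ qys) = (x≢y ∘ inj qx qy) ∷ images ne qys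

module _ {I : Set} {P Q : I → Set} (P? : Decidable P) (Q? : Decidable Q) where

  length-filter-⊎ : ∀ xs →
    length (filter (λ x → P? x ⊎-dec Q? x) xs) ≤ length (filter P? xs) + length (filter Q? xs)
  length-filter-⊎ [] = z≤n
  length-filter-⊎ (x ∷ xs) with P? x | Q? x
  ... | yes _ | yes _ = s≤s (≤-trans (length-filter-⊎ xs) (+-monoʳ-≤ (length (filter P? xs)) (n≤1+n _)))
  ... | yes _ | no _  = s≤s (length-filter-⊎ xs)
  ... | no _  | yes _ = subst (suc (length (filter (λ x → P? x ⊎-dec Q? x) xs)) ≤_)
      (sym (+-suc (length (filter P? xs)) (length (filter Q? xs)))) (s≤s (length-filter-⊎ xs))
  ... | no _  | no _  = length-filter-⊎ xs

below : ∀ {n} (D : ℕ) → Decidable (λ (v : Fin n) → toℕ v < D)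
below D v = toℕ v <? D

length-filter-below-suc : ∀ {n} D (vs : List (Fin n)) →
  length (filter (below (suc D)) (map suc vs)) ≡ length (filter (below D) vs)
length-filter-below-suc D []       = refl
length-filter-below-suc D (v ∷ vs) with toℕ v <ᵇ D
... | true  = cong suc (length-filter-below-suc D vs)
... | false = length-filter-below-suc D vs

count-below : ∀ n D → D ≤ n → length (filter (below D) (allFin n)) ≡ D
count-below n       zero    _         =
  cong length (filter-none (below 0) (All.universal (λ _ ()) (allFin n)))
count-below (suc n) (suc D) (s≤s D≤n) = cong suc (begin
  length (filter (below (suc D)) (tabulate {n = n} suc))
    ≡⟨ cong (length ∘ filter (below (suc D))) (map-tabulate {n = n} id suc) ⟨
  length (filter (below (suc D)) (map suc (allFin n)))
    ≡⟨ length-filter-below-suc D (allFin n) ⟩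
  length (filter (below D) (allFin n))
    ≡⟨ count-below n D D≤n ⟩
  D ∎)
  where open ≡-Reasoning

heavier-half : ∀ {a b L} → b ≤ a → L + L < a + b → L < a
heavier-half b≤a 2L<a+b = ≰⇒> λ a≤L → <⇒≱ 2L<a+b (+-mono-≤ a≤L (≤-trans b≤a a≤L))

module _ {n} {P : Fin n → Set} (P? : Decidable P) where

  weight : BTree n → ℕ
  weight t = length (filter P? (leaves t))

  weight-node : ∀ l r → weight (node l r) ≡ weight l + weight r
  weight-node l r =
    trans (cong length (filter-++ P? (leaves l) (leaves r))) (length-++ (filter P? (leaves l)))

  HasBalancedSubtree : ℕ → BTree n → Set
  HasBalancedSubtree L t = Σ (BTree n) λ s → s ∈ properSubtrees t × L ≤ weight s × weight s ≤ L + L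

  stopOrDescend : ∀ {L} t c → (∀ {s} → s ∈ c ∷ properSubtrees c → s ∈ properSubtrees t) →
    L < weight c → (L + L < weight c → HasBalancedSubtree L c) → HasBalancedSubtree L t
  stopOrDescend {L} t c lift L<c descend with weight c ≤? L + L
  ... | yes c≤2L = c , lift (here refl) , <⇒≤ L<c , c≤2L
  ... | no  c≰2L with descend (≰⇒> c≰2L)
  ...   | s , s∈c , lo , hi = s , lift (there s∈c) , lo , hi

  -- Balanced cut: a tree of weight more than 2L ≥ 2 has a proper subtree of weight in
  -- [L, 2L], found by descending into the heavier child, whose weight exceeds L.
  balancedSubtree : ∀ {L} → 1 ≤ L → ∀ t → L + L < weight t → HasBalancedSubtree L t
  balancedSubtree {L} 1≤L (leaf v) heavy =
    ⊥-elim (<⇒≱ heavy (≤-trans (length-filter P? (v ∷ [])) (≤-trans 1≤L (m≤m+n L L))))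
  balancedSubtree {L} 1≤L (node l r) heavy
    with weight r ≤? weight l | subst (L + L <_) (weight-node l r) heavy
  ... | yes r≤l | heavy′ =
    stopOrDescend (node l r) l ∈-++⁺ˡ (heavier-half r≤l heavy′) (balancedSubtree 1≤L l)
  ... | no  r≰l | heavy′ =
    stopOrDescend (node l r) r (∈-++⁺ʳ (l ∷ properSubtrees l))
      (heavier-half (<⇒≤ (≰⇒> r≰l)) (subst (L + L <_) (+-comm (weight l) (weight r)) heavy′))
      (balancedSubtree 1≤L r)

length-filter-↭++ : ∀ {I : Set} {P : I → Set} (P? : Decidable P) {xs ys zs : List I} →
  zs ↭ xs ++ ys → length (filter P? xs) + length (filter P? ys) ≡ length (filter P? zs)
length-filter-↭++ P? {xs} {ys} {zs} zs↭xs++ys = begin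
  length (filter P? xs) + length (filter P? ys) ≡⟨ length-++ (filter P? xs) ⟨
  length (filter P? xs ++ filter P? ys)         ≡⟨ cong length (filter-++ P? xs ys) ⟨
  length (filter P? (xs ++ ys))                 ≡⟨ ↭-length (filter-↭ P? zs↭xs++ys) ⟨
  length (filter P? zs)                         ∎
  where open ≡-Reasoning

subtree-split : ∀ {n} (t : BTree n) {s} → s ∈ properSubtrees t →
  Σ (List (Fin n)) λ rest → leaves t ↭ leaves s ++ rest
subtree-split (node l r) s∈ with ∈-++⁻ (l ∷ properSubtrees l) s∈
... | inj₁ (here refl)  = leaves r , ↭-refl
... | inj₂ (here refl)  = leaves l , ++-comm (leaves l) (leaves r)
... | inj₁ (there s∈l) with subtree-split l s∈l
...   | rest , split =
  rest ++ leaves r , ↭-trans (++⁺ʳ (leaves r) split) (↭-reflexive (++-assoc _ rest (leaves r)))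
subtree-split (node l r) {s} s∈ | inj₂ (there s∈r) with subtree-split r s∈r
...   | rest , split = leaves l ++ rest , ↭-trans (++⁺ˡ (leaves l) split) (shifts (leaves l) (leaves s))

segmentsIntersect? : ∀ tu bu tv bv → Dec (SegmentsIntersect tu bu tv bv)
segmentsIntersect? tu bu tv bv = ((tu ≤? tv) ×-dec (bv ≤? bu)) ⊎-dec ((tv ≤? tu) ×-dec (bu ≤? bv))

segmentsIntersect-sym : ∀ {tu bu tv bv} → SegmentsIntersect tu bu tv bv → SegmentsIntersect tv bv tu bu
segmentsIntersect-sym (inj₁ crossing) = inj₂ crossing
segmentsIntersect-sym (inj₂ crossing) = inj₁ crossing

parallel-meet : ∀ (f : ℕ → ℕ) → (∀ {x y} → f x ≤ f y → x ≤ y) →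
  ∀ {a b} → SegmentsIntersect a (f a) b (f b) → a ≡ b
parallel-meet f reflect (inj₁ (a≤b , fb≤fa)) = ≤-antisym a≤b (reflect fb≤fa)
parallel-meet f reflect (inj₂ (b≤a , fa≤fb)) = ≤-antisym (reflect fa≤fb) b≤a

outsideBand : ∀ {a b d} → b < a ⊎ a + d < b → ¬ SegmentsIntersect a (a + d) b b
outsideBand (inj₁ b<a)   (inj₁ (a≤b , _))   = <⇒≱ b<a a≤b
outsideBand (inj₂ a+d<b) (inj₁ (_ , b≤a+d)) = <⇒≱ a+d<b b≤a+d
outsideBand {a} (inj₁ b<a)   (inj₂ (_ , a+d≤b)) = <⇒≱ b<a (≤-trans (m≤m+n a _) a+d≤b)
outsideBand {a} (inj₂ a+d<b) (inj₂ (b≤a , _))   = <⇒≱ a+d<b (≤-trans b≤a (m≤m+n a _))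

does-true : ∀ {Q : Set} (q? : Dec Q) → does q? ≡ true → Q
does-true (yes q) _ = q

does-false : ∀ {Q : Set} (q? : Dec Q) → does q? ≡ false → ¬ Q
does-false (no ¬q) _ = ¬q

-- Each class consists of parallel segments, so it is independent, and X_a ~ Y_b iff
-- a ≤ b ≤ a + D.
module BandGraph (D M : ℕ) .{{_ : NonZero M}} where

  -- vertex v is X_i if splitAt M v = inj₁ i and Y_j if splitAt M v = inj₂ j
  top bot : Fin (M + M) → ℕ
  top v = [ toℕ , toℕ ]′ (splitAt M v)
  bot v = [ (λ i → toℕ i + D) , toℕ ]′ (splitAt M v)

  Meets : Fin (M + M) → Fin (M + M) → Set
  Meets u v = u ≢ v × SegmentsIntersect (top u) (bot u) (top v) (bot v)

  meets? : ∀ u v → Dec (Meets u v)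
  meets? u v = ¬? (u FinP.≟ v) ×-dec segmentsIntersect? (top u) (bot u) (top v) (bot v)

  meets-sym : ∀ {u v} → Meets u v → Meets v u
  meets-sym (u≢v , crossing) = u≢v ∘ sym , segmentsIntersect-sym crossing

  graph : Graph (M + M)
  graph = record
    { adj     = λ u v → does (meets? u v)
    ; adj-sym = λ u v → does-⇔ (mk⇔ meets-sym meets-sym) (meets? u v) (meets? v u)
    ; adj-irr = λ u → dec-false (meets? u u) (λ (u≢u , _) → u≢u refl)
    }

  isPermutationGraph : IsPermutationGraph graph
  isPermutationGraph = top , bot , λ u v → mk⇔ (does-true (meets? u v)) (dec-true (meets? u v))

  isX : Fin (M + M) → Bool
  isX v = [ (λ _ → true) , (λ _ → false) ]′ (splitAt M v)

  sameClass⇒disjoint : ∀ u v → isX u ≡ isX v →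
    SegmentsIntersect (top u) (bot u) (top v) (bot v) → u ≡ v
  sameClass⇒disjoint u v same crossing
    with splitAt M u in eu | splitAt M v in ev
  ... | inj₁ i | inj₁ j = trans (sym (splitAt⁻¹-↑ˡ eu))
    (trans (cong (_↑ˡ M) (FinP.toℕ-injective (parallel-meet (_+ D) (+-cancelʳ-≤ D _ _) crossing)))
           (splitAt⁻¹-↑ˡ ev))
  ... | inj₂ i | inj₂ j = trans (sym (splitAt⁻¹-↑ʳ eu))
    (trans (cong (M ↑ʳ_) (FinP.toℕ-injective (parallel-meet (λ x → x) (λ x≤y → x≤y) crossing)))
           (splitAt⁻¹-↑ʳ ev))

  isBipartite : IsBipartite graph
  isBipartite = isX , λ u v u~v same →
    let u≢v , crossing = does-true (meets? u v) u~v in u≢v (sameClass⇒disjoint u v same crossing)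

  isBipartitePermutationGraph : IsBipartitePermutationGraph graph
  isBipartitePermutationGraph = isPermutationGraph , isBipartite

  -- The vertices X_a and Y_b (indices are read modulo M).
  X Y : ℕ → Fin (M + M)
  X a = (a mod M) ↑ˡ M
  Y b = M ↑ʳ (b mod M)

  toℕ-mod : ∀ {a} → a < M → toℕ (a mod M) ≡ a
  toℕ-mod a<M = trans (FinP.toℕ-fromℕ< _) (m<n⇒m%n≡m a<M)

  X≢Y : ∀ {a b} → X a ≢ Y b
  X≢Y {a} {b} eq
    with () ← trans (sym (splitAt-↑ˡ M (a mod M) M)) (trans (cong (splitAt M) eq) (splitAt-↑ʳ M M (b mod M)))

  XY-segments : ∀ {a b} → a < M → b < M →
    SegmentsIntersect (top (X a)) (bot (X a)) (top (Y b)) (bot (Y b)) ≡ SegmentsIntersect a (a + D) b b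
  XY-segments {a} {b} a<M b<M
    rewrite splitAt-↑ˡ M (a mod M) M | splitAt-↑ʳ M M (b mod M) | toℕ-mod a<M | toℕ-mod b<M = refl

  adjacent-XY : ∀ {a b} → a < M → b < M → a ≤ b → b ≤ a + D → adj graph (X a) (Y b) ≡ true
  adjacent-XY a<M b<M a≤b b≤a+D =
    dec-true (meets? _ _) (X≢Y , subst id (sym (XY-segments a<M b<M)) (inj₁ (a≤b , b≤a+D)))

  nonadjacent-XY : ∀ {a b} → a < M → b < M → b < a ⊎ a + D < b → adj graph (X a) (Y b) ≡ false
  nonadjacent-XY a<M b<M apart =
    dec-false (meets? _ _)
      (λ (_ , crossing) → outsideBand apart (subst id (XY-segments a<M b<M) crossing))

  adjacent-YX : ∀ {a b} → a < M → b < M → a ≤ b → b ≤ a + D → adj graph (Y b) (X a) ≡ true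
  adjacent-YX a<M b<M a≤b b≤a+D = trans (adj-sym graph _ _) (adjacent-XY a<M b<M a≤b b≤a+D)

  nonadjacent-YX : ∀ {a b} → a < M → b < M → b < a ⊎ a + D < b → adj graph (Y b) (X a) ≡ false
  nonadjacent-YX a<M b<M apart = trans (adj-sym graph _ _) (nonadjacent-XY a<M b<M apart)

  X-toℕ : ∀ {v} → toℕ v < M → X (toℕ v) ≡ v
  X-toℕ {v} v<M = FinP.toℕ-injective (trans (FinP.toℕ-↑ˡ (toℕ v mod M) M) (toℕ-mod v<M))

-- Arithmetic of column positions: column c < D of the band graph consists of the
-- vertices with indices j * D + c.

column-step : ∀ j D c → suc j * D + c ≡ (j * D + c) + D
column-step = solve-∀

column-bound : ∀ {D c j J} → c < D → j < J → j * D + c < J * D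
column-bound {D} {c} {j} c<D j<J =
  <-≤-trans (+-monoʳ-< (j * D) c<D) (≤-trans (≤-reflexive (+-comm (j * D) D)) (*-monoˡ-≤ D j<J))

column-injective : ∀ {D c c′} j j′ → c < D → c′ < D → j * D + c ≡ j′ * D + c′ → c ≡ c′
column-injective {D} {c} {c′} j j′ c<D c′<D eq = begin
  c                ≡⟨ m<n⇒m%n≡m c<D ⟨
  c % D            ≡⟨ [m+kn]%n≡m%n c j D ⟨
  (c + j * D) % D  ≡⟨ cong (_% D) (trans (+-comm c (j * D)) (trans eq (+-comm (j′ * D) c′))) ⟩
  (c′ + j′ * D) % D ≡⟨ [m+kn]%n≡m%n c′ j′ D ⟩
  c′ % D           ≡⟨ m<n⇒m%n≡m c′<D ⟩
  c′               ∎
  where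
  open ≡-Reasoning
  instance
    D≢0 : NonZero D
    D≢0 = >-nonZero (≤-<-trans z≤n c<D)

earlier-row : ∀ {D c c′ j j′} → c′ < D → j < j′ → j * D + c′ < j′ * D + c
earlier-row {D} {c} {c′} {j} {j′} c′<D j<j′ =
  <-≤-trans (column-bound {j = j} c′<D ≤-refl) (≤-trans (*-monoˡ-≤ D j<j′) (m≤m+n (j′ * D) c))

within-row : ∀ {D c c′} j → c ≤ D → j * D + c ≤ (j * D + c′) + D
within-row {D} {c} {c′} j c≤D =
  subst (j * D + c ≤_) (sym (+-assoc (j * D) c′ D)) (+-monoʳ-≤ (j * D) (≤-trans c≤D (m≤n+m D c′)))

beyond-row : ∀ {D c c′ j j′} → c′ < c → j < j′ → (j * D + c′) + D < j′ * D + c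
beyond-row {D} {c} {c′} {j} {j′} c′<c j<j′ =
  subst (_< j′ * D + c) (column-step j D c′)
    (<-≤-trans (+-monoʳ-< (suc j * D) c′<c) (+-monoˡ-≤ c (*-monoˡ-≤ D j<j′)))

-- Column c < D consists of the vertices X_{jD+c}
-- and Y_{jD+c} (j < k), joined into a path by the edges X_{jD+c} Y_{jD+c} and
-- X_{jD+c} Y_{(j+1)D+c}.  A cut with at least L = 4k columns whose X_c lies on each
-- side has rank at least k.
module CutAnalysis (k D M : ℕ) .{{_ : NonZero M}} (kD≤M : k * D ≤ M) where

  open BandGraph D M public

  L : ℕ
  L = 4 * k

  position-bound : ∀ {c j} → c < D → j < k → j * D + c < M
  position-bound c<D j<k = <-≤-trans (column-bound c<D j<k) kD≤M

  module Cut (A : Fin (M + M) → Set) (A? : Decidable A) where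

    side : Fin (M + M) → Bool
    side v = does (A? v)

    Rank : Set
    Rank = CutRankAtLeast graph A k

    -- The four ways in which an edge X_a Y_a or X_a Y_{a+D} can cross the cut.
    InOut OutIn InOut⁺ OutIn⁺ Crossing : ℕ → Set
    InOut  a = side (X a) ≡ true  × side (Y a) ≡ false
    OutIn  a = side (X a) ≡ false × side (Y a) ≡ true
    InOut⁺ a = a + D < M × side (X a) ≡ true  × side (Y (a + D)) ≡ false
    OutIn⁺ a = a + D < M × side (X a) ≡ false × side (Y (a + D)) ≡ true
    Crossing a = InOut a ⊎ OutIn a ⊎ InOut⁺ a ⊎ OutIn⁺ a

    inOut? : Decidable InOut
    outIn? : Decidable OutIn
    inOut⁺? : Decidable InOut⁺
    outIn⁺? : Decidable OutIn⁺
    crossing? : Decidable Crossing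
    inOut?  a = (side (X a) ≟ᵇ true)  ×-dec (side (Y a) ≟ᵇ false)
    outIn?  a = (side (X a) ≟ᵇ false) ×-dec (side (Y a) ≟ᵇ true)
    inOut⁺? a = (a + D <? M) ×-dec (side (X a) ≟ᵇ true)  ×-dec (side (Y (a + D)) ≟ᵇ false)
    outIn⁺? a = (a + D <? M) ×-dec (side (X a) ≟ᵇ false) ×-dec (side (Y (a + D)) ≟ᵇ true)
    crossing? a = inOut? a ⊎-dec outIn? a ⊎-dec inOut⁺? a ⊎-dec outIn⁺? a

    inside : ∀ {v} → side v ≡ true → A v
    inside {v} = does-true (A? v)

    outside : ∀ {v} → side v ≡ false → ¬ A v
    outside {v} = does-false (A? v)

    -- k distinct crossing edges of one kind, named by the index a of their X-end.
    record Family (P : ℕ → Set) : Set where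
      field
        edges   : List ℕ
        unique  : Unique edges
        enough  : k ≤ length edges
        bounded : ∀ {a} → a ∈ edges → a < M
        kind    : ∀ {a} → a ∈ edges → P a

    reversed : ∀ {a b} → M ∸ a < M ∸ b → b < a
    reversed lt = ≰⇒> λ a≤b → <⇒≱ lt (∸-monoʳ-≤ M a≤b)

    reversed-injective : ∀ {a b} → a < M → b < M → M ∸ a ≡ M ∸ b → a ≡ b
    reversed-injective a<M b<M = ∸-cancelˡ-≡ (<⇒≤ a<M) (<⇒≤ b<M)

    rank-InOut : Family InOut → Rank
    rank-InOut F = triangular⇒cutRank graph A k unique enough record
      { row = X ; col = Y ; rank = λ a → a
      ; row∈A          = λ a∈ → inside (proj₁ (kind a∈))
      ; col∉A          = λ a∈ → outside (proj₂ (kind a∈))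
      ; pivot          = λ a∈ → adjacent-XY (bounded a∈) (bounded a∈) ≤-refl (m≤m+n _ D)
      ; rank-injective = λ _ _ eq → eq
      ; upper          = λ a∈ b∈ a<b → nonadjacent-XY (bounded b∈) (bounded a∈) (inj₁ a<b)
      }
      where open Family F

    rank-OutIn : Family OutIn → Rank
    rank-OutIn F = triangular⇒cutRank graph A k unique enough record
      { row = Y ; col = X ; rank = M ∸_
      ; row∈A          = λ a∈ → inside (proj₂ (kind a∈))
      ; col∉A          = λ a∈ → outside (proj₁ (kind a∈))
      ; pivot          = λ a∈ → adjacent-YX (bounded a∈) (bounded a∈) ≤-refl (m≤m+n _ D)
      ; rank-injective = λ a∈ b∈ → reversed-injective (bounded a∈) (bounded b∈)
      ; upper          = λ a∈ b∈ lt → nonadjacent-YX (bounded a∈) (bounded b∈) (inj₁ (reversed lt))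
      }
      where open Family F

    rank-InOut⁺ : Family InOut⁺ → Rank
    rank-InOut⁺ F = triangular⇒cutRank graph A k unique enough record
      { row = X ; col = λ a → Y (a + D) ; rank = M ∸_
      ; row∈A          = λ a∈ → inside (proj₁ (proj₂ (kind a∈)))
      ; col∉A          = λ a∈ → outside (proj₂ (proj₂ (kind a∈)))
      ; pivot          = λ a∈ → adjacent-XY (bounded a∈) (proj₁ (kind a∈)) (m≤m+n _ D) ≤-refl
      ; rank-injective = λ a∈ b∈ → reversed-injective (bounded a∈) (bounded b∈)
      ; upper          = λ a∈ b∈ lt →
          nonadjacent-XY (bounded b∈) (proj₁ (kind a∈)) (inj₂ (+-monoˡ-< D (reversed lt)))
      }
      where open Family F

    rank-OutIn⁺ : Family OutIn⁺ → Rank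
    rank-OutIn⁺ F = triangular⇒cutRank graph A k unique enough record
      { row = λ a → Y (a + D) ; col = X ; rank = λ a → a
      ; row∈A          = λ a∈ → inside (proj₂ (proj₂ (kind a∈)))
      ; col∉A          = λ a∈ → outside (proj₁ (proj₂ (kind a∈)))
      ; pivot          = λ a∈ → adjacent-YX (bounded a∈) (proj₁ (kind a∈)) (m≤m+n _ D) ≤-refl
      ; rank-injective = λ _ _ eq → eq
      ; upper          = λ a∈ b∈ a<b →
          nonadjacent-YX (bounded a∈) (proj₁ (kind b∈)) (inj₂ (+-monoˡ-< D a<b))
      }
      where open Family F

    Crossed : ℕ → Set
    Crossed c = ∃ λ j → j < k × Crossing (j * D + c)

    crossed? : Decidable Crossed
    crossed? c = anyUpTo? (λ j → crossing? (j * D + c)) k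

    sameSide : ∀ {x y} → ¬ (x ≡ true × y ≡ false) → ¬ (x ≡ false × y ≡ true) → x ≡ y
    sameSide {true}  {true}  _ _ = refl
    sameSide {false} {false} _ _ = refl
    sameSide {true}  {false} h _ = ⊥-elim (h (refl , refl))
    sameSide {false} {true}  _ h = ⊥-elim (h (refl , refl))

    uncrossed : ∀ {a} → ¬ Crossing a →
      side (X a) ≡ side (Y a) × (a + D < M → side (X a) ≡ side (Y (a + D)))
    uncrossed ¬cross =
      sameSide (¬cross ∘ inj₁) (¬cross ∘ inj₂ ∘ inj₁) ,
      λ a+D<M → sameSide (λ (i , o) → ¬cross (inj₂ (inj₂ (inj₁ (a+D<M , i , o)))))
                         (λ (o , i) → ¬cross (inj₂ (inj₂ (inj₂ (a+D<M , o , i)))))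

    -- Along an uncrossed column every vertex lies on the side of X_c: walk up the path
    -- X_c, Y_{D+c}, X_{D+c}, Y_{2D+c}, … and use that Y_{jD+c} is on the side of X_{jD+c}.
    uncrossedColumn : ∀ {c} → c < D → ¬ Crossed c → ∀ {j} → j < k →
      side (X (j * D + c)) ≡ side (X c) × side (Y (j * D + c)) ≡ side (X c)
    uncrossedColumn {c} c<D ¬crossed {i} i<k =
      sideX i i<k , trans (sym (proj₁ (edgeSides i<k))) (sideX i i<k)
      where
      edgeSides : ∀ {j} → j < k →
        side (X (j * D + c)) ≡ side (Y (j * D + c)) ×
        (j * D + c + D < M → side (X (j * D + c)) ≡ side (Y (j * D + c + D)))
      edgeSides {j} j<k = uncrossed (λ cross → ¬crossed (j , j<k , cross))

      sideX : ∀ j → j < k → side (X (j * D + c)) ≡ side (X c)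
      sideX zero    _      = refl
      sideX (suc j) 1+j<k = begin
        side (X (suc j * D + c)) ≡⟨ proj₁ (edgeSides 1+j<k) ⟩
        side (Y (suc j * D + c)) ≡⟨ cong (side ∘ Y) (column-step j D c) ⟩
        side (Y (j * D + c + D)) ≡⟨ proj₂ (edgeSides j<k) (subst (_< M) (column-step j D c) (position-bound c<D 1+j<k)) ⟨
        side (X (j * D + c))     ≡⟨ sideX j j<k ⟩
        side (X c)               ∎
        where
        open ≡-Reasoning
        j<k : j < k
        j<k = <-trans (n<1+n j) 1+j<k

    rows : k ≤ length (upTo k)
    rows = ≤-reflexive (sym (length-upTo k))

    bound : ∀ {c j} → c < D → j ∈ upTo k → j * D + c < M
    bound c<D j∈ = position-bound c<D (∈-upTo⁻ j∈)

    rank-columns : ∀ {c c′} → c < D → c′ < D → ¬ Crossed c → ¬ Crossed c′ →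
      side (X c) ≡ true → side (X c′) ≡ false → Rank
    rank-columns {c} {c′} c<D c′<D ¬crossed ¬crossed′ X∈A X′∉A with <-cmp c c′
    ... | tri≈ _ refl _ with () ← trans (sym X∈A) X′∉A
    ... | tri< c<c′ _ _ = triangular⇒cutRank graph A k (upTo⁺ k) rows record
      { row = λ j → X (j * D + c) ; col = λ j → Y (j * D + c′) ; rank = λ j → j
      ; row∈A          = λ j∈ → inside (trans (proj₁ (uncrossedColumn c<D ¬crossed (∈-upTo⁻ j∈))) X∈A)
      ; col∉A          = λ j∈ → outside (trans (proj₂ (uncrossedColumn c′<D ¬crossed′ (∈-upTo⁻ j∈))) X′∉A)
      ; pivot          = λ {j} j∈ → adjacent-XY (bound c<D j∈) (bound c′<D j∈)
                           (+-monoʳ-≤ (j * D) (<⇒≤ c<c′)) (within-row j (<⇒≤ c′<D))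
      ; rank-injective = λ _ _ eq → eq
      ; upper          = λ j∈ j′∈ j<j′ →
          nonadjacent-XY (bound c<D j′∈) (bound c′<D j∈) (inj₁ (earlier-row c′<D j<j′))
      }
    ... | tri> _ _ c′<c = triangular⇒cutRank graph A k (upTo⁺ k) rows record
      { row = λ j → Y (j * D + c) ; col = λ j → X (j * D + c′) ; rank = λ j → j
      ; row∈A          = λ j∈ → inside (trans (proj₂ (uncrossedColumn c<D ¬crossed (∈-upTo⁻ j∈))) X∈A)
      ; col∉A          = λ j∈ → outside (trans (proj₁ (uncrossedColumn c′<D ¬crossed′ (∈-upTo⁻ j∈))) X′∉A)
      ; pivot          = λ {j} j∈ → adjacent-YX (bound c′<D j∈) (bound c<D j∈)
                           (+-monoʳ-≤ (j * D) (<⇒≤ c′<c)) (within-row j (<⇒≤ c<D))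
      ; rank-injective = λ _ _ eq → eq
      ; upper          = λ j∈ j′∈ j<j′ →
          nonadjacent-YX (bound c′<D j∈) (bound c<D j′∈) (inj₂ (beyond-row c′<c j<j′))
      }

    crossingRow : ℕ → ℕ
    crossingRow c with crossed? c
    ... | yes (j , _) = j
    ... | no _        = 0

    crossingEdge : ℕ → ℕ
    crossingEdge c = crossingRow c * D + c

    crossingEdge-spec : ∀ {c} → c < D → Crossed c → crossingEdge c < M × Crossing (crossingEdge c)
    crossingEdge-spec {c} c<D crossed with crossed? c
    ... | yes (_ , j<k , crossing) = position-bound c<D j<k , crossing
    ... | no ¬crossed              = ⊥-elim (¬crossed crossed)

    fourBelow : ∀ {a b c d} → a < k → b < k → c < k → d < k → a + (b + (c + d)) < L
    fourBelow {a} {b} {c} {d} a<k b<k c<k d<k =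
      subst (a + (b + (c + d)) <_) (cong (λ x → k + (k + (k + x))) (sym (+-identityʳ k)))
      (+-mono-< a<k (+-mono-< b<k (+-mono-< c<k d<k)))

    -- L crossed columns: their crossing edges are distinct, so by pigeonhole k of them
    -- cross in the same way, and these form a triangular system.
    rank-crossed : ∀ (C : List ℕ) → Unique C → L ≤ length C →
      (∀ {c} → c ∈ C → c < D) → (∀ {c} → c ∈ C → Crossed c) → Rank
    rank-crossed C uniqueC L≤C columnC crossedC =
      choose (k ≤? count inOut?) (k ≤? count outIn?) (k ≤? count inOut⁺?) (k ≤? count outIn⁺?)
      where
      es : List ℕ
      es = map crossingEdge C

      unique-es : Unique es
      unique-es = unique-map⁺ crossingEdge (λ {c} {c′} → column-injective (crossingRow c) (crossingRow c′))
                    uniqueC (All.tabulate columnC)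

      es-spec : ∀ {a} → a ∈ es → a < M × Crossing a
      es-spec a∈ with ∈-map⁻ crossingEdge a∈
      ... | c , c∈ , refl = crossingEdge-spec (columnC c∈) (crossedC c∈)

      count : ∀ {P : ℕ → Set} → Decidable P → ℕ
      count P? = length (filter P? es)

      family : ∀ {P : ℕ → Set} (P? : Decidable P) → k ≤ count P? → Family P
      family P? enough = record
        { edges   = filter P? es
        ; unique  = filter⁺ P? unique-es
        ; enough  = enough
        ; bounded = proj₁ ∘ es-spec ∘ proj₁ ∘ ∈-filter⁻ P? {xs = es}
        ; kind    = proj₂ ∘ ∈-filter⁻ P? {xs = es}
        }

      shifted? : Decidable (λ a → InOut⁺ a ⊎ OutIn⁺ a)
      shifted? a = inOut⁺? a ⊎-dec outIn⁺? a

      otherThanInOut? : Decidable (λ a → OutIn a ⊎ InOut⁺ a ⊎ OutIn⁺ a)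
      otherThanInOut? a = outIn? a ⊎-dec shifted? a

      pigeonhole : L ≤ count inOut? + (count outIn? + (count inOut⁺? + count outIn⁺?))
      pigeonhole = begin
        L                       ≤⟨ L≤C ⟩
        length C                ≡⟨ length-map crossingEdge C ⟨
        length es               ≡⟨ cong length (filter-all crossing? (All.tabulate (proj₂ ∘ es-spec))) ⟨
        count crossing?         ≤⟨ length-filter-⊎ inOut? otherThanInOut? es ⟩
        count inOut? + count otherThanInOut?
          ≤⟨ +-monoʳ-≤ (count inOut?) (length-filter-⊎ outIn? shifted? es) ⟩
        count inOut? + (count outIn? + count shifted?)
          ≤⟨ +-monoʳ-≤ (count inOut?) (+-monoʳ-≤ (count outIn?) (length-filter-⊎ inOut⁺? outIn⁺? es)) ⟩
        count inOut? + (count outIn? + (count inOut⁺? + count outIn⁺?)) ∎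
        where open ≤-Reasoning

      choose : Dec (k ≤ count inOut?) → Dec (k ≤ count outIn?) →
               Dec (k ≤ count inOut⁺?) → Dec (k ≤ count outIn⁺?) → Rank
      choose (yes enough) _            _            _            = rank-InOut  (family inOut? enough)
      choose (no _)       (yes enough) _            _            = rank-OutIn  (family outIn? enough)
      choose (no _)       (no _)       (yes enough) _            = rank-InOut⁺ (family inOut⁺? enough)
      choose (no _)       (no _)       (no _)       (yes enough) = rank-OutIn⁺ (family outIn⁺? enough)
      choose (no few₁)    (no few₂)    (no few₃)    (no few₄)    =
        ⊥-elim (<⇒≱ (fourBelow (≰⇒> few₁) (≰⇒> few₂) (≰⇒> few₃) (≰⇒> few₄)) pigeonhole)

    -- If at least L columns have their X-vertex inside A and at least L outside, the cut
    -- has rank ≥ k: either all columns of one of these groups are crossed, or each group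
    -- contains an uncrossed column.
    rank-cut : ∀ (CA CB : List ℕ) → Unique CA → Unique CB → L ≤ length CA → L ≤ length CB →
      (∀ {c} → c ∈ CA → c < D × A (X c)) → (∀ {c} → c ∈ CB → c < D × ¬ A (X c)) → Rank
    rank-cut CA CB uniqueA uniqueB L≤A L≤B inA outB with All.all? crossed? CA | All.all? crossed? CB
    ... | yes crossedA | _ = rank-crossed CA uniqueA L≤A (proj₁ ∘ inA) (All.lookup crossedA)
    ... | no _ | yes crossedB = rank-crossed CB uniqueB L≤B (proj₁ ∘ outB) (All.lookup crossedB)
    ... | no someA | no someB
      with find (All.¬All⇒Any¬ crossed? CA someA) | find (All.¬All⇒Any¬ crossed? CB someB)
    ...   | c , c∈ , ¬crossed | c′ , c′∈ , ¬crossed′ =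
      rank-columns (proj₁ (inA c∈)) (proj₁ (outB c′∈)) ¬crossed ¬crossed′
        (dec-true (A? (X c)) (proj₂ (inA c∈))) (dec-false (A? (X c′)) (proj₂ (outB c′∈)))

module RankBound (k′ : ℕ) where

  k D M n : ℕ
  k = suc k′
  D = 4 * k + (4 * k + 4 * k)
  M = k * D
  n = M + M

  open CutAnalysis k D M ≤-refl public
  open import Data.List.Membership.DecPropositional (FinP._≟_ {n}) using (_∈?_)

  -- The column vertices X_c (c < D) are the vertices of index below D.
  isColumn? : Decidable (λ (v : Fin n) → toℕ v < D)
  isColumn? = below D

  L≥1 : 1 ≤ L
  L≥1 = s≤s z≤n

  D≤M : D ≤ M
  D≤M = m≤m+n D (k′ * D)

  D≤n : D ≤ n
  D≤n = ≤-trans D≤M (m≤m+n M M)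

  columnsIn : List (Fin n) → List ℕ
  columnsIn vs = map toℕ (filter isColumn? vs)

  columnsIn-spec : ∀ {vs c} → c ∈ columnsIn vs → c < D × X c ∈ vs
  columnsIn-spec {vs} c∈ with ∈-map⁻ toℕ c∈
  ... | v , v∈ , refl with ∈-filter⁻ isColumn? {xs = vs} v∈
  ...   | v∈vs , v<D = v<D , subst (_∈ vs) (sym (X-toℕ (<-≤-trans v<D D≤M))) v∈vs

  columnsIn-unique : ∀ {vs} → Unique vs → Unique (columnsIn vs)
  columnsIn-unique unique = map⁺ FinP.toℕ-injective (filter⁺ isColumn? unique)

  length-columnsIn : ∀ vs → length (columnsIn vs) ≡ length (filter isColumn? vs)
  length-columnsIn vs = length-map toℕ (filter isColumn? vs)

  -- A subtree holding between L and 2L of the D column vertices X_c leaves at least L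
  -- of them outside, so its cut has rank ≥ k.
  cutRank-subtree : ∀ {t s} → IsDecompositionTree t → s ∈ properSubtrees t →
    L ≤ weight isColumn? s → weight isColumn? s ≤ L + L → CutRankAtLeast graph (cutOf s) k
  cutRank-subtree {t} {s} t↭all s∈t L≤s s≤2L with subtree-split t s∈t
  ... | rest , split =
    Cut.rank-cut (cutOf s) (_∈? leaves s) (columnsIn (leaves s)) (columnsIn rest)
      (columnsIn-unique unique-s) (columnsIn-unique unique-rest)
      (subst (L ≤_) (sym (length-columnsIn (leaves s))) L≤s)
      (subst (L ≤_) (sym (length-columnsIn rest)) L≤rest)
      columnsIn-spec
      (λ c∈ → let c<D , X∈ = columnsIn-spec c∈ in c<D , disjoint X∈)
    where
    all↭split : allFin n ↭ leaves s ++ rest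
    all↭split = ↭-trans (↭-sym t↭all) split

    unique-split : Unique (leaves s ++ rest)
    unique-split = unique-↭ all↭split (allFin⁺ n)

    unique-s : Unique (leaves s)
    unique-s = proj₁ (unique-++⁻ (leaves s) unique-split)

    unique-rest : Unique rest
    unique-rest = proj₁ (proj₂ (unique-++⁻ (leaves s) unique-split))

    disjoint : ∀ {v} → v ∈ rest → v ∉ leaves s
    disjoint = proj₂ (proj₂ (unique-++⁻ (leaves s) unique-split))

    total : weight isColumn? s + length (filter isColumn? rest) ≡ D
    total = trans (length-filter-↭++ isColumn? {leaves s} all↭split) (count-below n D D≤n)

    L≤rest : L ≤ length (filter isColumn? rest)
    L≤rest = ≮⇒≥ λ rest<L →
      <-irrefl total (subst (weight isColumn? s + length (filter isColumn? rest) <_) (+-comm (L + L) L)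
                            (+-mono-≤-< s≤2L rest<L))

  columnsHeavy : ∀ {t : BTree n} → IsDecompositionTree t → L + L < weight isColumn? t
  columnsHeavy t↭all =
    subst (L + L <_) (sym (trans (↭-length (filter-↭ isColumn? t↭all)) (count-below n D D≤n)))
      (+-monoˡ-< (L + L) L≥1)

  rankWidth : RankWidthAtLeast graph k
  rankWidth t t↭all with balancedSubtree isColumn? L≥1 t (columnsHeavy {t} t↭all)
  ... | s , s∈t , L≤s , s≤2L = s , s∈t , cutRank-subtree {t} t↭all s∈t L≤s s≤2L

  size-upper : 1 ^ 2 * n ≤ (5 * k) ^ 2
  size-upper = subst (1 ^ 2 * n ≤_) (square k) (m≤m+n (1 ^ 2 * n) (k * k))
    where
    square : ∀ x → (x * (4 * x + (4 * x + 4 * x)) + x * (4 * x + (4 * x + 4 * x))) + 0 + x * x ≡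
                   5 * x * (5 * x * 1)
    square = solve-∀

  size-lower : k′ ≤ n
  size-lower = ≤-trans (n≤1+n k′) (≤-trans (m≤m*n k D) (m≤m+n M M))

-- The theorem, with c = 1/5: for every m, taking k = m + 1, the band graph with D = 12k
-- and M = kD is a bipartite permutation graph on n = 24k² ≥ m vertices whose rank-width
-- is at least k ≥ √n / 5.
mainTheorem11 : Σ ℕ λ p → Σ ℕ λ q → 1 ≤ p × 1 ≤ q ×
    ((m : ℕ) → Σ ℕ λ n → m ≤ n × Σ (Graph n) λ G →
      IsBipartitePermutationGraph G ×
      Σ ℕ λ k → (p ^ 2) * n ≤ (q * k) ^ 2 × RankWidthAtLeast G k)
mainTheorem11 = 1 , 5 , s≤s z≤n , s≤s z≤n , λ m →
  let open RankBound m in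
  n , size-lower , graph , isBipartitePermutationGraph , k , size-upper , rankWidth
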